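{- For each integer $n\ge1$: (1) $\widetilde{\mathcal{H}}_{n+1}(x)=\sum_{k=0}^{\lfloor n/2\rfloor}\left(\binom{n-k}{k}+\binom{n-k-1}{k}x\right)x^k(1+x)^{n-k-1}$; (2) $\widetilde{\mathcal{I}}_{n+1}(x)=\sum_{k=0}^{\lfloor (n-1)/3\rfloor}\left(\binom{n-2k-2}{k}+\binom{n-2k-1}{k}x\right)x^{n-2k-1}(1+x)^k$.
   Context: $D'(a,b)$ and $D''(a,b)$ denote the numbers of lattice paths from $(0,0)$ to $(a,b)$ with steps in $\{(1,0),(1,1),(0,1),(0,2)\}$ and $\{(2,1),(1,2),(0,1)\}$ respectively. For $n\ge0$ let $\mathcal{H}_{n+1}(x)=\sum_{k=0}^nD'(n-k,k)x^k$ and $\mathcal{I}_{n+1}(x)=\sum_{k=0}^nD''(n-k,k)x^k$, and set $\mathcal H_m(x)=\mathcal I_m(x)=0$ for $m\le0$. For all integers $n$ define $\widetilde{\mathcal{H}}_n(x)=\mathcal{H}_n(x)-x^2\mathcal{H}_{n-2}(x)$ and $\widetilde{\mathcal{I}}_n(x)=x\mathcal{I}_{n-1}(x)+x\mathcal{I}_{n-2}(x)$. Binomial coefficients $\binom{m}{k}$ are taken to be $0$ unless $0\le k\le m$. -}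

module Defs where

open import Level using (Level)
open import Data.Nat using (ℕ; zero; suc; _∸_)
import Data.Nat as ℕ
open import Data.Nat.Combinatorics using (_C_)
open import Data.Integer using (ℤ; +_; -[1+_])
open import Algebra.Bundles using (CommutativeRing; Semiring)
import Algebra.Definitions.RawSemiring as RS

-- D'(a,b): number of lattice paths (0,0) → (a,b) with steps
-- (1,0),(1,1),(0,1),(0,2), computed by classifying paths by their last step.
D′ : ℕ → ℕ → ℕ
D′ zero zero = 1
D′ zero (suc zero) = D′ zero zero
D′ zero (suc (suc b)) = D′ zero (suc b) ℕ.+ D′ zero b
D′ (suc a) zero = D′ a zero
D′ (suc a) (suc zero) = D′ a (suc zero) ℕ.+ D′ a zero ℕ.+ D′ (suc a) zero
D′ (suc a) (suc (suc b)) =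
  D′ a (suc (suc b)) ℕ.+ D′ a (suc b) ℕ.+ D′ (suc a) (suc b) ℕ.+ D′ (suc a) b

-- D''(a,b): number of lattice paths (0,0) → (a,b) with steps
-- (2,1),(1,2),(0,1), computed by classifying paths by their last step.
D″ : ℕ → ℕ → ℕ
D″ zero zero = 1
D″ zero (suc b) = D″ zero b
D″ (suc zero) zero = 0
D″ (suc zero) (suc zero) = D″ (suc zero) zero
D″ (suc zero) (suc (suc b)) = D″ zero b ℕ.+ D″ (suc zero) (suc b)
D″ (suc (suc a)) zero = 0
D″ (suc (suc a)) (suc zero) = D″ a zero ℕ.+ D″ (suc (suc a)) zero
D″ (suc (suc a)) (suc (suc b)) =
  D″ a (suc b) ℕ.+ D″ (suc a) b ℕ.+ D″ (suc (suc a)) (suc b)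

binomℤ : ℤ → ℕ → ℕ
binomℤ (+ m) k = m C k
binomℤ -[1+ _ ] k = 0

module Poly {c ℓ : Level} (R : CommutativeRing c ℓ) where
  open CommutativeRing R public
    using (Carrier; _≈_; _+_; _*_; _-_; -_; 0#; 1#; semiring)
  open RS (Semiring.rawSemiring semiring) using (_×_)
  open RS (Semiring.rawSemiring semiring) public using (_^_)

  ι : ℕ → Carrier
  ι n = n × 1#

  sumTo : ℕ → (ℕ → Carrier) → Carrier
  sumTo zero f = f zero
  sumTo (suc m) f = sumTo m f + f (suc m)

  rowPoly : (ℕ → ℕ → ℕ) → Carrier → ℕ → Carrier
  rowPoly D x n = sumTo n (λ k → ι (D (n ∸ k) k) * x ^ k)

  𝓗 : Carrier → ℕ → Carrier
  𝓗 x zero = 0#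
  𝓗 x (suc n) = rowPoly D′ x n

  𝓘 : Carrier → ℕ → Carrier
  𝓘 x zero = 0#
  𝓘 x (suc n) = rowPoly D″ x n

-- Reading off the last step of a path gives linear recurrences for the row polynomials:
-- 𝓗_{r+3} = (1+x)(𝓗_{r+2} + x 𝓗_{r+1}) and 𝓘_{r+4} = x(𝓘_{r+3} + (1+x) 𝓘_{r+1}).
-- By Pascal's rule the shallow-diagonal sums P(c) = Σ_k C(c − s k, k) u^(c − s k) v^k satisfy
-- P(c + s + 1) = u (P(c + s) + v P(c)); for (s, u, v) = (1, 1+x, x) and (2, x, 1+x) these are the
-- recurrences above, and the initial values agree, so 𝓗_{c+1} = P(c) and 𝓘_{c+1} = P(c).
-- The closed form for 𝓗̃ is one more application of Pascal's rule to P, and the one for 𝓘̃ a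
-- shift of the exponent of u.
module Submission where

open import Defs
open import Level using (Level)
open import Data.Nat using (ℕ; zero; suc; z≤n; s≤s; _≤_; _<_; _≥_; NonZero)
import Data.Nat as ℕ
import Data.Nat.Properties as ℕₚ
open ℕₚ using (≰⇒>; <⇒≱; ≤-trans; ≤-refl; ≤-pred; m≤n+m; m≤n⇒m<n∨m≡n; m≤n⇒m≤1+n; n≤1+n;
  +-suc)
open import Data.Nat.DivMod using (_/_; /-monoˡ-≤; m*n/n≡m; m/n≤m)
open import Data.Nat.Combinatorics using (_C_; nCk+nC[k+1]≡[n+1]C[k+1]; k>n⇒nCk≡0)
open import Data.Integer using (_⊖_)
open import Data.Integer.Properties using (⊖-≥; [1+m]⊖[1+n]≡m⊖n)
open import Data.Product using (_×_; _,_)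
open import Data.Sum using (inj₁; inj₂)
open import Relation.Nullary using (yes; no)
open import Relation.Binary.PropositionalEquality as ≡ using (_≡_; cong)
open import Relation.Binary.Bundles using (Setoid)
open import Algebra.Bundles using (CommutativeRing)
import Algebra.Definitions as AlgebraDefinitions

-- C(p − q, k), taken to be 0 (not C(0, k)) when p < q, as binomℤ does for a negative top.
[_∸_]C_ : ℕ → ℕ → ℕ → ℕ
[ p ∸ zero ]C k = p C k
[ zero ∸ suc q ]C k = 0
[ suc p ∸ suc q ]C k = [ p ∸ q ]C k

binomℤ-⊖ : ∀ p q k → binomℤ (p ⊖ q) k ≡ [ p ∸ q ]C k
binomℤ-⊖ p zero k = cong (λ z → binomℤ z k) (⊖-≥ z≤n)
binomℤ-⊖ zero (suc q) k = ≡.refl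
binomℤ-⊖ (suc p) (suc q) k =
  ≡.trans (cong (λ z → binomℤ z k) ([1+m]⊖[1+n]≡m⊖n p q)) (binomℤ-⊖ p q k)

binomℤ-⊖-+ : ∀ p q r k → binomℤ (p ⊖ (q ℕ.+ r)) k ≡ [ p ∸ r ℕ.+ q ]C k
binomℤ-⊖-+ p q r k =
  ≡.trans (cong (λ t → binomℤ (p ⊖ t) k) (ℕₚ.+-comm q r)) (binomℤ-⊖ p (r ℕ.+ q) k)

p<q+k⇒[p∸q]Ck≡0 : ∀ p q k → p < q ℕ.+ k → [ p ∸ q ]C k ≡ 0
p<q+k⇒[p∸q]Ck≡0 p zero k p<k = k>n⇒nCk≡0 p<k
p<q+k⇒[p∸q]Ck≡0 zero (suc q) k _ = ≡.refl
p<q+k⇒[p∸q]Ck≡0 (suc p) (suc q) k (s≤s p<q+k) = p<q+k⇒[p∸q]Ck≡0 p q k p<q+k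

[p∸q]Ck+[p∸q]C[1+k]≡[1+p∸q]C[1+k] :
  ∀ p q k → [ p ∸ q ]C k ℕ.+ [ p ∸ q ]C suc k ≡ [ suc p ∸ q ]C suc k
[p∸q]Ck+[p∸q]C[1+k]≡[1+p∸q]C[1+k] p zero k = nCk+nC[k+1]≡[n+1]C[k+1] p k
[p∸q]Ck+[p∸q]C[1+k]≡[1+p∸q]C[1+k] zero (suc q) k =
  ≡.sym (p<q+k⇒[p∸q]Ck≡0 0 q (suc k) (≤-trans (s≤s z≤n) (m≤n+m (suc k) q)))
[p∸q]Ck+[p∸q]C[1+k]≡[1+p∸q]C[1+k] (suc p) (suc q) k = [p∸q]Ck+[p∸q]C[1+k]≡[1+p∸q]C[1+k] p q k

[s+p∸s+q]Ck≡[p∸q]Ck : ∀ s p q k → [ s ℕ.+ p ∸ s ℕ.+ q ]C k ≡ [ p ∸ q ]C k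
[s+p∸s+q]Ck≡[p∸q]Ck zero p q k = ≡.refl
[s+p∸s+q]Ck≡[p∸q]Ck (suc s) p q k = [s+p∸s+q]Ck≡[p∸q]Ck s p q k

diagonal-pascal : ∀ s m k →
  [ s ℕ.+ suc m ∸ s ℕ.* suc k ]C suc k ≡ [ s ℕ.+ m ∸ s ℕ.* suc k ]C suc k ℕ.+ [ m ∸ s ℕ.* k ]C k
diagonal-pascal s m k = begin
  [ s ℕ.+ suc m ∸ s ℕ.* suc k ]C suc k    ≡⟨ cong ([ s ℕ.+ suc m ∸_]C suc k) (ℕₚ.*-suc s k) ⟩
  [ s ℕ.+ suc m ∸ s ℕ.+ sk ]C suc k       ≡⟨ [s+p∸s+q]Ck≡[p∸q]Ck s (suc m) sk (suc k) ⟩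
  [ suc m ∸ sk ]C suc k                   ≡⟨ [p∸q]Ck+[p∸q]C[1+k]≡[1+p∸q]C[1+k] m sk k ⟨
  [ m ∸ sk ]C k ℕ.+ [ m ∸ sk ]C suc k     ≡⟨ ℕₚ.+-comm ([ m ∸ sk ]C k) _ ⟩
  [ m ∸ sk ]C suc k ℕ.+ [ m ∸ sk ]C k
    ≡⟨ cong (ℕ._+ [ m ∸ sk ]C k) ([s+p∸s+q]Ck≡[p∸q]Ck s m sk (suc k)) ⟨
  [ s ℕ.+ m ∸ s ℕ.+ sk ]C suc k ℕ.+ [ m ∸ sk ]C k
    ≡⟨ cong (λ q → [ s ℕ.+ m ∸ q ]C suc k ℕ.+ [ m ∸ sk ]C k) (ℕₚ.*-suc s k) ⟨
  [ s ℕ.+ m ∸ s ℕ.* suc k ]C suc k ℕ.+ [ m ∸ sk ]C k ∎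
  where
  open ≡.≡-Reasoning
  sk = s ℕ.* k

[1+m]∸n∸1≡m∸n : ∀ m n → suc m ℕ.∸ n ℕ.∸ 1 ≡ m ℕ.∸ n
[1+m]∸n∸1≡m∸n m n = ≡.trans (ℕₚ.∸-+-assoc (suc m) n 1) (cong (suc m ℕ.∸_) (ℕₚ.+-comm n 1))

m/n<k⇒m<k*n : ∀ {m n k} .{{_ : NonZero n}} → m / n < k → m < k ℕ.* n
m/n<k⇒m<k*n {m} {n} {k} m/n<k = ≰⇒> λ k*n≤m →
  <⇒≱ m/n<k (≡.subst (_≤ m / n) (m*n/n≡m k n) (/-monoˡ-≤ n k*n≤m))

m/[1+s]<k⇒m<s*k+k : ∀ {m} s {k} → m / suc s < k → m < s ℕ.* k ℕ.+ k
m/[1+s]<k⇒m<s*k+k {m} s {k} m/[1+s]<k =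
  ≡.subst (m <_) (≡.trans (ℕₚ.*-comm k (suc s)) (ℕₚ.+-comm k (s ℕ.* k))) (m/n<k⇒m<k*n m/[1+s]<k)

shift₁ : (ℕ → ℕ → ℕ) → ℕ → ℕ → ℕ
shift₁ D zero b = 0
shift₁ D (suc a) b = D a b

shift₂ : (ℕ → ℕ → ℕ) → ℕ → ℕ → ℕ
shift₂ D a zero = 0
shift₂ D a (suc b) = D a b

D′-zeroʳ : ∀ a → D′ a 0 ≡ 1
D′-zeroʳ zero = ≡.refl
D′-zeroʳ (suc a) = D′-zeroʳ a

D′-suc : ∀ a b → D′ a (suc b) ≡
  shift₁ (λ a b → D′ a (suc b)) a b ℕ.+ shift₁ D′ a b ℕ.+ D′ a b ℕ.+ shift₂ D′ a b
D′-suc zero zero = ≡.refl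
D′-suc zero (suc b) = ≡.refl
D′-suc (suc a) zero = ≡.sym (ℕₚ.+-identityʳ _)
D′-suc (suc a) (suc b) = ≡.refl

D″-zeroʳ : ∀ a → D″ (suc a) 0 ≡ 0
D″-zeroʳ zero = ≡.refl
D″-zeroʳ (suc a) = ≡.refl

D″-suc : ∀ a b → D″ a (suc b) ≡ D″ a b ℕ.+ shift₁ (shift₁ D″) a b ℕ.+ shift₂ (shift₁ D″) a b
D″-suc zero zero = ≡.refl
D″-suc zero (suc b) = ≡.sym (≡.trans (ℕₚ.+-identityʳ _) (ℕₚ.+-identityʳ _))
D″-suc (suc zero) zero = ≡.refl
D″-suc (suc zero) (suc b) =
  ≡.trans (ℕₚ.+-comm (D″ 0 b) _) (cong (ℕ._+ D″ 0 b) (≡.sym (ℕₚ.+-identityʳ _)))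
D″-suc (suc (suc a)) zero = ≡.refl
D″-suc (suc (suc a)) (suc b) =
  ≡.trans (ℕₚ.+-comm (D″ a (suc b) ℕ.+ D″ (suc a) b) _)
          (≡.sym (ℕₚ.+-assoc (D″ (suc (suc a)) (suc b)) _ _))

module _ {a ℓ} (S : Setoid a ℓ) where
  open Setoid S
  open AlgebraDefinitions _≈_ using (Congruent₂)

  recurrence-unique : ∀ d (step : Carrier → Carrier → Carrier) → Congruent₂ step →
    {f g : ℕ → Carrier} →
    (∀ m → f (d ℕ.+ suc m) ≈ step (f (d ℕ.+ m)) (f m)) →
    (∀ m → g (d ℕ.+ suc m) ≈ step (g (d ℕ.+ m)) (g m)) →
    (∀ j → j ≤ d → f j ≈ g j) → ∀ m → f m ≈ g m
  recurrence-unique d step step-cong {f} {g} f-rec g-rec initial m = agree m (m≤n+m m d)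
    where
    agree : ∀ m {j} → j ≤ d ℕ.+ m → f j ≈ g j
    agree zero j≤d+0 = initial _ (≡.subst (_ ≤_) (ℕₚ.+-identityʳ d) j≤d+0)
    agree (suc m) {j} j≤d+1+m with m≤n⇒m<n∨m≡n j≤d+1+m
    ... | inj₁ j<d+1+m = agree m (≤-pred (≡.subst (j <_) (+-suc d m) j<d+1+m))
    ... | inj₂ ≡.refl =
      trans (f-rec m) (trans (step-cong (agree m ≤-refl) (agree m (m≤n+m m d))) (sym (g-rec m)))

module _ {c ℓ : Level} (R : CommutativeRing c ℓ) where
  open Poly R
  open CommutativeRing R using (setoid; refl; sym; trans; reflexive; +-cong; *-cong; +-assoc; +-comm;
    *-identityʳ; distribˡ; distribʳ; zeroˡ; zeroʳ; +-identityˡ; +-identityʳ; commutativeSemiring;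
    +-group)
  open import Algebra.Properties.Semiring.Mult semiring using (×-homo-1; ×-homo-+)
  open import Algebra.Properties.Group +-group using (//-rightDividesʳ)
  open import Algebra.Solver.Ring.NaturalCoefficients.Default commutativeSemiring
    using (solve; _:=_; _:+_; _:*_; con)
  open import Relation.Binary.Reasoning.Setoid setoid

  ι≡0⇒ι*y*z≈0 : ∀ {n} → n ≡ 0 → ∀ y z → ι n * y * z ≈ 0#
  ι≡0⇒ι*y*z≈0 ≡.refl y z = trans (*-cong (zeroˡ y) refl) (zeroˡ z)

  sumTo-cong : ∀ m {f g : ℕ → Carrier} → (∀ k → k ≤ m → f k ≈ g k) → sumTo m f ≈ sumTo m g
  sumTo-cong zero f≈g = f≈g 0 z≤n
  sumTo-cong (suc m) f≈g =
    +-cong (sumTo-cong m (λ k k≤m → f≈g k (m≤n⇒m≤1+n k≤m))) (f≈g (suc m) ≤-refl)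

  sumTo-+ : ∀ m (f g : ℕ → Carrier) → sumTo m (λ k → f k + g k) ≈ sumTo m f + sumTo m g
  sumTo-+ zero f g = refl
  sumTo-+ (suc m) f g = trans (+-cong (sumTo-+ m f g) refl)
    (solve 4 (λ F G a b → (F :+ G) :+ (a :+ b) := (F :+ a) :+ (G :+ b)) refl _ _ _ _)

  sumTo-*ˡ : ∀ m y (f : ℕ → Carrier) → sumTo m (λ k → y * f k) ≈ y * sumTo m f
  sumTo-*ˡ zero y f = refl
  sumTo-*ˡ (suc m) y f = trans (+-cong (sumTo-*ˡ m y f) refl) (sym (distribˡ y _ _))

  sumTo-+-*ˡ : ∀ m y (f g : ℕ → Carrier) →
    sumTo m (λ k → f k + y * g k) ≈ sumTo m f + y * sumTo m g
  sumTo-+-*ˡ m y f g = trans (sumTo-+ m f _) (+-cong refl (sumTo-*ˡ m y g))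

  sumTo-suc : ∀ m (f : ℕ → Carrier) → sumTo (suc m) f ≈ f 0 + sumTo m (λ k → f (suc k))
  sumTo-suc zero f = refl
  sumTo-suc (suc m) f = trans (+-cong (sumTo-suc m f) refl) (+-assoc _ _ _)

  sumTo-vanishing : ∀ {M N} (f : ℕ → Carrier) → (∀ k → M < k → f k ≈ 0#) → M ≤ N →
    sumTo N f ≈ sumTo M f
  sumTo-vanishing {N = zero} f f≈0 z≤n = refl
  sumTo-vanishing {N = suc N} f f≈0 M≤1+N with m≤n⇒m<n∨m≡n M≤1+N
  ... | inj₁ (s≤s M≤N) =
    trans (+-cong (sumTo-vanishing f f≈0 M≤N) (f≈0 (suc N) (s≤s M≤N))) (+-identityʳ _)
  ... | inj₂ ≡.refl = refl

  -- The exponent e in term is kept apart from the row c because the closed forms of the theorem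
  -- have exponents one below the row.
  module Diagonal (s : ℕ) (u v : Carrier) where
    term : ℕ → ℕ → ℕ → Carrier
    term e c k = ι ([ c ∸ s ℕ.* k ]C k) * u ^ (e ℕ.∸ s ℕ.* k) * v ^ k

    diagonal : ℕ → Carrier
    diagonal c = sumTo c (term c c)

    term-vanishes : ∀ e c k → c < s ℕ.* k ℕ.+ k → term e c k ≈ 0#
    term-vanishes e c k c<sk+k = ι≡0⇒ι*y*z≈0 (p<q+k⇒[p∸q]Ck≡0 c (s ℕ.* k) k c<sk+k) _ _

    term-vanishes-above : ∀ e c k → c < k → term e c k ≈ 0#
    term-vanishes-above e c k c<k = term-vanishes e c k (ℕₚ.<-≤-trans c<k (m≤n+m k (s ℕ.* k)))

    term-vanishes-beyond : ∀ e c k → c / suc s < k → term e c k ≈ 0#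
    term-vanishes-beyond e c k c/[1+s]<k = term-vanishes e c k (m/[1+s]<k⇒m<s*k+k s c/[1+s]<k)

    term-zero : ∀ e c → term e c 0 ≈ u ^ e
    term-zero e c rewrite ℕₚ.*-zeroʳ s =
      solve 1 (λ U → (con 1 :+ con 0) :* U :* con 1 := U) refl (u ^ e)

    -- When s k > e the coefficient vanishes, so the truncated exponents do no harm.
    term-pow-suc : ∀ {e c} k → c ≤ suc e → term (suc e) c k ≈ u * term e c k
    term-pow-suc {e} {c} zero _ = trans (term-zero (suc e) c) (*-cong refl (sym (term-zero e c)))
    term-pow-suc {e} {c} k@(suc _) c≤1+e with s ℕ.* k ℕ.≤? e
    ... | yes sk≤e = begin
      ι C * u ^ (suc e ℕ.∸ s ℕ.* k) * v ^ k
        ≈⟨ *-cong (*-cong refl (reflexive (cong (u ^_) (ℕₚ.+-∸-assoc 1 sk≤e)))) refl ⟩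
      ι C * (u * u ^ (e ℕ.∸ s ℕ.* k)) * v ^ k
        ≈⟨ solve 4 (λ C U U′ V → C :* (U :* U′) :* V := U :* (C :* U′ :* V)) refl (ι C) u _ _ ⟩
      u * term e c k ∎
      where C = [ c ∸ s ℕ.* k ]C k
    ... | no sk≰e = begin
      term (suc e) c k            ≈⟨ term-vanishes (suc e) c k c<sk+k ⟩
      0#                          ≈⟨ sym (zeroʳ u) ⟩
      u * 0#                      ≈⟨ *-cong refl (sym (term-vanishes e c k c<sk+k)) ⟩
      u * term e c k ∎
      where
      c<sk+k : c < s ℕ.* k ℕ.+ k
      c<sk+k = ℕₚ.≤-<-trans (≤-trans c≤1+e (≰⇒> sk≰e)) (ℕₚ.m<m+n (s ℕ.* k) (s≤s z≤n))

    term-pascal : ∀ e m k →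
      term e (s ℕ.+ suc m) (suc k) ≈ term e (s ℕ.+ m) (suc k) + v * term (e ℕ.∸ s) m k
    term-pascal e m k = begin
      ι ([ s ℕ.+ suc m ∸ s ℕ.* suc k ]C suc k) * U * (v * v ^ k)
        ≈⟨ *-cong (*-cong (trans (reflexive (cong ι (diagonal-pascal s m k))) (×-homo-+ 1# B C)) refl)
                  refl ⟩
      (ι B + ι C) * U * (v * v ^ k)
        ≈⟨ solve 5 (λ B C U v V → (B :+ C) :* U :* (v :* V) := B :* U :* (v :* V) :+ v :* (C :* U :* V))
                   refl (ι B) (ι C) U v (v ^ k) ⟩
      term e (s ℕ.+ m) (suc k) + v * (ι C * U * v ^ k)
        ≈⟨ +-cong refl (*-cong refl (*-cong (*-cong refl (reflexive (cong (u ^_) exponent))) refl)) ⟩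
      term e (s ℕ.+ m) (suc k) + v * term (e ℕ.∸ s) m k ∎
      where
      B = [ s ℕ.+ m ∸ s ℕ.* suc k ]C suc k
      C = [ m ∸ s ℕ.* k ]C k
      U = u ^ (e ℕ.∸ s ℕ.* suc k)
      exponent : e ℕ.∸ s ℕ.* suc k ≡ e ℕ.∸ s ℕ.∸ s ℕ.* k
      exponent = ≡.trans (cong (e ℕ.∸_) (ℕₚ.*-suc s k)) (≡.sym (ℕₚ.∸-+-assoc e s (s ℕ.* k)))

    pascal-split : ∀ N e m → sumTo (suc N) (term e (s ℕ.+ suc m))
      ≈ sumTo (suc N) (term e (s ℕ.+ m)) + v * sumTo N (term (e ℕ.∸ s) m)
    pascal-split N e m = begin
      sumTo (suc N) (term e (s ℕ.+ suc m))
        ≈⟨ sumTo-suc N _ ⟩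
      term e (s ℕ.+ suc m) 0 + sumTo N (λ k → term e (s ℕ.+ suc m) (suc k))
        ≈⟨ +-cong (trans (term-zero e _) (sym (term-zero e _)))
                  (sumTo-cong N (λ k _ → term-pascal e m k)) ⟩
      term e (s ℕ.+ m) 0 + sumTo N (λ k → term e (s ℕ.+ m) (suc k) + v * term (e ℕ.∸ s) m k)
        ≈⟨ +-cong refl (sumTo-+-*ˡ N v _ _) ⟩
      term e (s ℕ.+ m) 0
        + (sumTo N (λ k → term e (s ℕ.+ m) (suc k)) + v * sumTo N (term (e ℕ.∸ s) m))
        ≈⟨ trans (sym (+-assoc _ _ _)) (+-cong (sym (sumTo-suc N _)) refl) ⟩
      sumTo (suc N) (term e (s ℕ.+ m)) + v * sumTo N (term (e ℕ.∸ s) m) ∎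

    diagonal-rec : ∀ m → diagonal (s ℕ.+ suc m) ≈ u * (diagonal (s ℕ.+ m) + v * diagonal m)
    diagonal-rec m = begin
      diagonal (s ℕ.+ suc m)
        ≡⟨ cong (λ t → sumTo t (term t (s ℕ.+ suc m))) (+-suc s m) ⟩
      sumTo (suc (s ℕ.+ m)) (term (suc (s ℕ.+ m)) (s ℕ.+ suc m))
        ≈⟨ sumTo-cong (suc (s ℕ.+ m)) (λ k _ → term-pow-suc k (ℕₚ.≤-reflexive (+-suc s m))) ⟩
      sumTo (suc (s ℕ.+ m)) (λ k → u * term (s ℕ.+ m) (s ℕ.+ suc m) k)
        ≈⟨ sumTo-*ˡ (suc (s ℕ.+ m)) u _ ⟩
      u * sumTo (suc (s ℕ.+ m)) (term (s ℕ.+ m) (s ℕ.+ suc m))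
        ≈⟨ *-cong refl (pascal-split (s ℕ.+ m) (s ℕ.+ m) m) ⟩
      u * (sumTo (suc (s ℕ.+ m)) (term (s ℕ.+ m) (s ℕ.+ m))
             + v * sumTo (s ℕ.+ m) (term (s ℕ.+ m ℕ.∸ s) m))
        ≈⟨ *-cong refl (+-cong (sumTo-vanishing _ (term-vanishes-above _ _) (n≤1+n _))
             (*-cong refl (reflexive (cong (λ e → sumTo (s ℕ.+ m) (term e m)) (ℕₚ.m+n∸m≡n s m))))) ⟩
      u * (diagonal (s ℕ.+ m) + v * sumTo (s ℕ.+ m) (term m m))
        ≈⟨ *-cong refl (+-cong refl
             (*-cong refl (sumTo-vanishing _ (term-vanishes-above _ _) (m≤n+m m s)))) ⟩
      u * (diagonal (s ℕ.+ m) + v * diagonal m) ∎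

  module _ (x : Carrier) where
    rowPoly-cong : ∀ {D E} r → (∀ a b → D a b ≡ E a b) → rowPoly D x r ≈ rowPoly E x r
    rowPoly-cong r D≡E = sumTo-cong r (λ k _ → *-cong (reflexive (cong ι (D≡E _ _))) refl)

    rowPoly-+ : ∀ D E r → rowPoly (λ a b → D a b ℕ.+ E a b) x r ≈ rowPoly D x r + rowPoly E x r
    rowPoly-+ D E r = trans
      (sumTo-cong r (λ k _ →
        trans (*-cong (×-homo-+ 1# (D (r ℕ.∸ k) k) (E (r ℕ.∸ k) k)) refl) (distribʳ _ _ _)))
      (sumTo-+ r _ _)

    rowPoly-suc : ∀ D r →
      rowPoly D x (suc r) ≈ ι (D (suc r) 0) + x * rowPoly (λ a b → D a (suc b)) x r
    rowPoly-suc D r = trans (sumTo-suc r _) (+-cong (*-identityʳ _) (trans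
      (sumTo-cong r (λ k _ → solve 3 (λ A x X → A :* (x :* X) := x :* (A :* X)) refl _ x _))
      (sumTo-*ˡ r x _)))

    rowPoly-shift₁ : ∀ D r → rowPoly (shift₁ D) x (suc r) ≈ rowPoly D x r
    rowPoly-shift₁ D r = trans (+-cong
      (sumTo-cong r (λ k k≤r →
        *-cong (reflexive (cong (λ a → ι (shift₁ D a k)) (ℕₚ.+-∸-assoc 1 k≤r))) refl))
      (trans (*-cong (reflexive (cong (λ a → ι (shift₁ D a (suc r))) (ℕₚ.n∸n≡0 r))) refl)
             (zeroˡ _)))
      (+-identityʳ _)

    rowPoly-shift₂ : ∀ D r → rowPoly (shift₂ D) x (suc r) ≈ x * rowPoly D x r
    rowPoly-shift₂ D r = trans (rowPoly-suc (shift₂ D) r) (+-identityˡ _)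

    𝓗-rec : ∀ r → 𝓗 x (3 ℕ.+ r) ≈ (1# + x) * (𝓗 x (2 ℕ.+ r) + x * 𝓗 x (suc r))
    𝓗-rec r = begin
      h (2 ℕ.+ r)                                          ≈⟨ h-suc (suc r) ⟩
      1# + x * h⁺ (suc r)                                  ≈⟨ +-cong refl (*-cong refl h⁺-suc) ⟩
      1# + x * (h⁺ r + h r + h (suc r) + x * h r)
        ≈⟨ solve 5 (λ x U H₀ H₁ X → con 1 :+ x :* (U :+ H₀ :+ H₁ :+ X) :=
                                     (con 1 :+ x :* U) :+ x :* (H₀ :+ H₁ :+ X)) refl x _ _ _ _ ⟩
      (1# + x * h⁺ r) + x * (h r + h (suc r) + x * h r)   ≈⟨ +-cong (sym (h-suc r)) refl ⟩
      h (suc r) + x * (h r + h (suc r) + x * h r)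
        ≈⟨ solve 3 (λ x H₀ H₁ → H₁ :+ x :* (H₀ :+ H₁ :+ x :* H₀) := (con 1 :+ x) :* (H₁ :+ x :* H₀))
                   refl x _ _ ⟩
      (1# + x) * (h (suc r) + x * h r) ∎
      where
      h h⁺ : ℕ → Carrier
      h = rowPoly D′ x
      h⁺ = rowPoly (λ a b → D′ a (suc b)) x
      A B : ℕ → ℕ → ℕ
      A = shift₁ (λ a b → D′ a (suc b))
      B = shift₁ D′
      h-suc : ∀ r → h (suc r) ≈ 1# + x * h⁺ r
      h-suc r = trans (rowPoly-suc D′ r)
        (+-cong (trans (reflexive (cong ι (D′-zeroʳ (suc r)))) (×-homo-1 1#)) refl)
      h⁺-suc : h⁺ (suc r) ≈ h⁺ r + h r + h (suc r) + x * h r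
      h⁺-suc = begin
        h⁺ (suc r)
          ≈⟨ rowPoly-cong (suc r) D′-suc ⟩
        rowPoly (λ a b → A a b ℕ.+ B a b ℕ.+ D′ a b ℕ.+ shift₂ D′ a b) x (suc r)
          ≈⟨ trans (rowPoly-+ (λ a b → A a b ℕ.+ B a b ℕ.+ D′ a b) (shift₂ D′) (suc r))
               (+-cong (trans (rowPoly-+ (λ a b → A a b ℕ.+ B a b) D′ (suc r))
                              (+-cong (rowPoly-+ A B (suc r)) refl)) refl) ⟩
        rowPoly A x (suc r) + rowPoly B x (suc r) + h (suc r) + rowPoly (shift₂ D′) x (suc r)
          ≈⟨ +-cong (+-cong (+-cong (rowPoly-shift₁ _ r) (rowPoly-shift₁ D′ r)) refl) (rowPoly-shift₂ D′ r) ⟩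
        h⁺ r + h r + h (suc r) + x * h r ∎

    𝓘-rec : ∀ r → 𝓘 x (4 ℕ.+ r) ≈ x * (𝓘 x (3 ℕ.+ r) + (1# + x) * 𝓘 x (suc r))
    𝓘-rec r = begin
      i (3 ℕ.+ r)                               ≈⟨ rowPoly-suc D″ (2 ℕ.+ r) ⟩
      ι (D″ (3 ℕ.+ r) 0) + x * i⁺ (2 ℕ.+ r)
        ≈⟨ trans (+-cong (reflexive (cong ι (D″-zeroʳ (2 ℕ.+ r)))) refl) (+-identityˡ _) ⟩
      x * i⁺ (2 ℕ.+ r)                          ≈⟨ *-cong refl i⁺-suc ⟩
      x * (i (2 ℕ.+ r) + i r + x * i r)
        ≈⟨ solve 3 (λ x I₂ I₀ → x :* (I₂ :+ I₀ :+ x :* I₀) := x :* (I₂ :+ (con 1 :+ x) :* I₀))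
                   refl x _ _ ⟩
      x * (i (2 ℕ.+ r) + (1# + x) * i r) ∎
      where
      i i⁺ : ℕ → Carrier
      i = rowPoly D″ x
      i⁺ = rowPoly (λ a b → D″ a (suc b)) x
      i⁺-suc : i⁺ (2 ℕ.+ r) ≈ i (2 ℕ.+ r) + i r + x * i r
      i⁺-suc = begin
        i⁺ (2 ℕ.+ r)
          ≈⟨ rowPoly-cong (2 ℕ.+ r) D″-suc ⟩
        rowPoly (λ a b → D″ a b ℕ.+ shift₁ (shift₁ D″) a b ℕ.+ shift₂ (shift₁ D″) a b) x (2 ℕ.+ r)
          ≈⟨ trans (rowPoly-+ (λ a b → D″ a b ℕ.+ shift₁ (shift₁ D″) a b) (shift₂ (shift₁ D″)) (2 ℕ.+ r))
               (+-cong (rowPoly-+ D″ (shift₁ (shift₁ D″)) (2 ℕ.+ r)) refl) ⟩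
        i (2 ℕ.+ r) + rowPoly (shift₁ (shift₁ D″)) x (2 ℕ.+ r) + rowPoly (shift₂ (shift₁ D″)) x (2 ℕ.+ r)
          ≈⟨ +-cong (+-cong refl (trans (rowPoly-shift₁ _ (suc r)) (rowPoly-shift₁ D″ r)))
                    (trans (rowPoly-shift₂ _ (suc r)) (*-cong refl (rowPoly-shift₁ D″ r))) ⟩
        i (2 ℕ.+ r) + i r + x * i r ∎

    module D₁ = Diagonal 1 (1# + x) x
    module D₂ = Diagonal 2 x (1# + x)

    𝓗≈diagonal : ∀ c → 𝓗 x (suc c) ≈ D₁.diagonal c
    𝓗≈diagonal = recurrence-unique setoid 1 (λ y z → (1# + x) * (y + x * z))
      (λ y≈y′ z≈z′ → *-cong refl (+-cong y≈y′ (*-cong refl z≈z′))) 𝓗-rec D₁.diagonal-rec initial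
      where
      initial : ∀ j → j ≤ 1 → 𝓗 x (suc j) ≈ D₁.diagonal j
      initial zero _ = solve 0 ((con 1 :+ con 0) :* con 1 := (con 1 :+ con 0) :* con 1 :* con 1) refl
      initial (suc zero) _ = solve 1 (λ x →
        (con 1 :+ con 0) :* con 1 :+ (con 1 :+ con 0) :* (x :* con 1) :=
        (con 1 :+ con 0) :* ((con 1 :+ x) :* con 1) :* con 1 :+ con 0 :* con 1 :* (x :* con 1)) refl x
      initial (suc (suc _)) (s≤s ())

    𝓘≈diagonal : ∀ c → 𝓘 x (suc c) ≈ D₂.diagonal c
    𝓘≈diagonal = recurrence-unique setoid 2 (λ y z → x * (y + (1# + x) * z))
      (λ y≈y′ z≈z′ → *-cong refl (+-cong y≈y′ (*-cong refl z≈z′))) 𝓘-rec D₂.diagonal-rec initial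
      where
      initial : ∀ j → j ≤ 2 → 𝓘 x (suc j) ≈ D₂.diagonal j
      initial zero _ = solve 0 ((con 1 :+ con 0) :* con 1 := (con 1 :+ con 0) :* con 1 :* con 1) refl
      initial (suc zero) _ = solve 1 (λ x →
        con 0 :* con 1 :+ (con 1 :+ con 0) :* (x :* con 1) :=
        (con 1 :+ con 0) :* (x :* con 1) :* con 1 :+ con 0 :* con 1 :* ((con 1 :+ x) :* con 1)) refl x
      initial (suc (suc zero)) _ = solve 1 (λ x →
        con 0 :* con 1 :+ con 0 :* (x :* con 1) :+ (con 1 :+ con 0) :* (x :* (x :* con 1)) :=
        (con 1 :+ con 0) :* (x :* (x :* con 1)) :* con 1 :+ con 0 :* con 1 :* ((con 1 :+ x) :* con 1)
          :+ con 0 :* con 1 :* ((con 1 :+ x) :* ((con 1 :+ x) :* con 1))) refl x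
      initial (suc (suc (suc _))) (s≤s (s≤s ()))

    𝓗-split : ∀ m → sumTo (suc m) (D₁.term m (suc m)) ≈ 𝓗 x (suc m) + x * 𝓗 x m
    𝓗-split zero = solve 1 (λ x →
      (con 1 :+ con 0) :* con 1 :* con 1 :+ con 0 :* con 1 :* (x :* con 1) :=
      (con 1 :+ con 0) :* con 1 :+ x :* con 0) refl x
    𝓗-split (suc m) = begin
      sumTo (2 ℕ.+ m) (D₁.term (suc m) (2 ℕ.+ m))
        ≈⟨ D₁.pascal-split (suc m) (suc m) m ⟩
      sumTo (2 ℕ.+ m) (D₁.term (suc m) (suc m)) + x * sumTo (suc m) (D₁.term m m)
        ≈⟨ +-cong (sumTo-vanishing _ (D₁.term-vanishes-above (suc m) (suc m)) (n≤1+n (suc m)))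
                  (*-cong refl (sumTo-vanishing _ (D₁.term-vanishes-above m m) (n≤1+n m))) ⟩
      D₁.diagonal (suc m) + x * D₁.diagonal m
        ≈⟨ sym (+-cong (𝓗≈diagonal (suc m)) (*-cong refl (𝓗≈diagonal m))) ⟩
      𝓗 x (2 ℕ.+ m) + x * 𝓗 x (suc m) ∎

    𝓗-tilde-diagonal : ∀ m → 𝓗 x (2 ℕ.+ m) - x ^ 2 * 𝓗 x m
      ≈ sumTo (suc m) (D₁.term m (suc m)) + x * sumTo (suc m) (D₁.term m m)
    𝓗-tilde-diagonal m = begin
      𝓗 x (2 ℕ.+ m) - x ^ 2 * H₀                           ≈⟨ +-cong 𝓗[2+m]≈ refl ⟩
      (1# + x) * (H₁ + x * H₀) - x ^ 2 * H₀
        ≈⟨ +-cong (solve 3 (λ x H₀ H₁ → (con 1 :+ x) :* (H₁ :+ x :* H₀) :=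
                                        ((H₁ :+ x :* H₀) :+ x :* H₁) :+ x :* (x :* con 1) :* H₀)
                           refl x H₀ H₁) refl ⟩
      ((H₁ + x * H₀) + x * H₁) + x ^ 2 * H₀ - x ^ 2 * H₀    ≈⟨ //-rightDividesʳ (x ^ 2 * H₀) _ ⟩
      (H₁ + x * H₀) + x * H₁
        ≈⟨ sym (+-cong (𝓗-split m) (*-cong refl diagonal≈H₁)) ⟩
      sumTo (suc m) (D₁.term m (suc m)) + x * sumTo (suc m) (D₁.term m m) ∎
      where
      H₀ = 𝓗 x m
      H₁ = 𝓗 x (suc m)
      𝓗[2+m]≈ : 𝓗 x (2 ℕ.+ m) ≈ (1# + x) * (H₁ + x * H₀)
      𝓗[2+m]≈ = trans (𝓗≈diagonal (suc m)) (trans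
        (sumTo-cong (suc m) (λ k _ → D₁.term-pow-suc {m} {suc m} k ≤-refl))
        (trans (sumTo-*ˡ (suc m) (1# + x) _) (*-cong refl (𝓗-split m))))
      diagonal≈H₁ : sumTo (suc m) (D₁.term m m) ≈ H₁
      diagonal≈H₁ =
        trans (sumTo-vanishing _ (D₁.term-vanishes-above m m) (n≤1+n m)) (sym (𝓗≈diagonal m))

    -- Part of the summand of 𝓘̃_{m+2}; for m = 1 + m′ it is definitionally D₂.term m m′ k.
    𝓘-tilde-lower : ℕ → ℕ → Carrier
    𝓘-tilde-lower m k = ι ([ m ∸ suc (2 ℕ.* k) ]C k) * x ^ (m ℕ.∸ 2 ℕ.* k) * (1# + x) ^ k

    𝓘-tilde-lower-sum : ∀ m → sumTo m (𝓘-tilde-lower m) ≈ x * 𝓘 x m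
    𝓘-tilde-lower-sum zero = solve 1 (λ x → con 0 :* con 1 :* con 1 := x :* con 0) refl x
    𝓘-tilde-lower-sum (suc m) = begin
      sumTo (suc m) (D₂.term (suc m) m)
        ≈⟨ sumTo-cong (suc m) (λ k _ → D₂.term-pow-suc {m} {m} k (n≤1+n m)) ⟩
      sumTo (suc m) (λ k → x * D₂.term m m k)
        ≈⟨ sumTo-*ˡ (suc m) x _ ⟩
      x * sumTo (suc m) (D₂.term m m)
        ≈⟨ *-cong refl (sumTo-vanishing _ (D₂.term-vanishes-above m m) (n≤1+n m)) ⟩
      x * D₂.diagonal m
        ≈⟨ *-cong refl (sym (𝓘≈diagonal m)) ⟩
      x * 𝓘 x (suc m) ∎

    𝓘-tilde-diagonal : ∀ m → x * 𝓘 x (suc m) + x * 𝓘 x m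
      ≈ sumTo m (𝓘-tilde-lower m) + x * sumTo m (D₂.term m m)
    𝓘-tilde-diagonal m =
      trans (+-comm _ _) (+-cong (sym (𝓘-tilde-lower-sum m)) (*-cong refl (𝓘≈diagonal m)))

    𝓗-tilde-summand : ℕ → ℕ → Carrier
    𝓗-tilde-summand n k =
      (ι (binomℤ (n ⊖ k) k) + ι (binomℤ (n ⊖ (k ℕ.+ 1)) k) * x) * x ^ k * (1# + x) ^ (n ℕ.∸ k ℕ.∸ 1)

    𝓘-tilde-summand : ℕ → ℕ → Carrier
    𝓘-tilde-summand n k =
      (ι (binomℤ (n ⊖ (2 ℕ.* k ℕ.+ 2)) k) + ι (binomℤ (n ⊖ (2 ℕ.* k ℕ.+ 1)) k) * x)
        * x ^ (n ℕ.∸ 2 ℕ.* k ℕ.∸ 1) * (1# + x) ^ k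

    𝓗-tilde-summand-split : ∀ m k →
      𝓗-tilde-summand (suc m) k ≈ D₁.term m (suc m) k + x * D₁.term m m k
    𝓗-tilde-summand-split m k = begin
      𝓗-tilde-summand (suc m) k
        ≈⟨ reflexive (≡.cong₂ (λ p q → (ι p + ι q * x) * x ^ k * (1# + x) ^ (suc m ℕ.∸ k ℕ.∸ 1))
                               (≡.trans (binomℤ-⊖ (suc m) k k) (1*k (λ j → [ suc m ∸ j ]C k)))
                               (≡.trans (binomℤ-⊖-+ (suc m) k 1 k) (1*k (λ j → [ m ∸ j ]C k)))) ⟩
      (ι ([ suc m ∸ 1 ℕ.* k ]C k) + ι ([ m ∸ 1 ℕ.* k ]C k) * x) * x ^ k * (1# + x) ^ (suc m ℕ.∸ k ℕ.∸ 1)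
        ≈⟨ *-cong refl (reflexive (cong ((1# + x) ^_) (≡.trans ([1+m]∸n∸1≡m∸n m k) (1*k (m ℕ.∸_))))) ⟩
      (ι ([ suc m ∸ 1 ℕ.* k ]C k) + ι ([ m ∸ 1 ℕ.* k ]C k) * x) * x ^ k * (1# + x) ^ (m ℕ.∸ 1 ℕ.* k)
        ≈⟨ solve 5 (λ A B x X Y → (A :+ B :* x) :* X :* Y := A :* Y :* X :+ x :* (B :* Y :* X))
                   refl _ _ x _ _ ⟩
      D₁.term m (suc m) k + x * D₁.term m m k ∎
      where
      1*k : ∀ (P : ℕ → ℕ) → P k ≡ P (1 ℕ.* k)
      1*k P = cong P (≡.sym (ℕₚ.*-identityˡ k))

    𝓘-tilde-summand-split : ∀ m k →
      𝓘-tilde-summand (suc m) k ≈ 𝓘-tilde-lower m k + x * D₂.term m m k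
    𝓘-tilde-summand-split m k = begin
      𝓘-tilde-summand (suc m) k
        ≈⟨ reflexive (≡.cong₂ (λ p q → (ι p + ι q * x) * x ^ (suc m ℕ.∸ 2k ℕ.∸ 1) * (1# + x) ^ k)
                              (binomℤ-⊖-+ (suc m) 2k 2 k) (binomℤ-⊖-+ (suc m) 2k 1 k)) ⟩
      (ι ([ m ∸ suc 2k ]C k) + ι ([ m ∸ 2k ]C k) * x) * x ^ (suc m ℕ.∸ 2k ℕ.∸ 1) * (1# + x) ^ k
        ≈⟨ *-cong (*-cong refl (reflexive (cong (x ^_) ([1+m]∸n∸1≡m∸n m 2k)))) refl ⟩
      (ι ([ m ∸ suc 2k ]C k) + ι ([ m ∸ 2k ]C k) * x) * x ^ (m ℕ.∸ 2k) * (1# + x) ^ k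
        ≈⟨ solve 5 (λ A B x X Y → (A :+ B :* x) :* X :* Y := A :* X :* Y :+ x :* (B :* X :* Y))
                   refl _ _ x _ _ ⟩
      𝓘-tilde-lower m k + x * D₂.term m m k ∎
      where 2k = 2 ℕ.* k

    𝓗-tilde-closed-form : ∀ m →
      𝓗 x (2 ℕ.+ m) - x ^ 2 * 𝓗 x m ≈ sumTo (suc m / 2) (𝓗-tilde-summand (suc m))
    𝓗-tilde-closed-form m = begin
      𝓗 x (2 ℕ.+ m) - x ^ 2 * 𝓗 x m
        ≈⟨ 𝓗-tilde-diagonal m ⟩
      sumTo (suc m) (D₁.term m (suc m)) + x * sumTo (suc m) (D₁.term m m)
        ≈⟨ +-cong (sumTo-vanishing {suc m / 2} _ (D₁.term-vanishes-beyond m (suc m)) (m/n≤m (suc m) 2))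
                  (*-cong refl (sumTo-vanishing {suc m / 2} _ beyond-half (m/n≤m (suc m) 2))) ⟩
      sumTo (suc m / 2) (D₁.term m (suc m)) + x * sumTo (suc m / 2) (D₁.term m m)
        ≈⟨ sym (sumTo-+-*ˡ (suc m / 2) x _ _) ⟩
      sumTo (suc m / 2) (λ k → D₁.term m (suc m) k + x * D₁.term m m k)
        ≈⟨ sumTo-cong (suc m / 2) (λ k _ → sym (𝓗-tilde-summand-split m k)) ⟩
      sumTo (suc m / 2) (𝓗-tilde-summand (suc m)) ∎
      where
      beyond-half : ∀ k → suc m / 2 < k → D₁.term m m k ≈ 0#
      beyond-half k h = D₁.term-vanishes-beyond m m k (ℕₚ.≤-<-trans (/-monoˡ-≤ 2 (n≤1+n m)) h)

    𝓘-tilde-closed-form : ∀ m →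
      x * 𝓘 x (suc m) + x * 𝓘 x m ≈ sumTo (m / 3) (𝓘-tilde-summand (suc m))
    𝓘-tilde-closed-form m = begin
      x * 𝓘 x (suc m) + x * 𝓘 x m
        ≈⟨ 𝓘-tilde-diagonal m ⟩
      sumTo m (𝓘-tilde-lower m) + x * sumTo m (D₂.term m m)
        ≈⟨ +-cong (sumTo-vanishing {m / 3} _ beyond-third (m/n≤m m 3))
                  (*-cong refl (sumTo-vanishing {m / 3} _ (D₂.term-vanishes-beyond m m) (m/n≤m m 3))) ⟩
      sumTo (m / 3) (𝓘-tilde-lower m) + x * sumTo (m / 3) (D₂.term m m)
        ≈⟨ sym (sumTo-+-*ˡ (m / 3) x _ _) ⟩
      sumTo (m / 3) (λ k → 𝓘-tilde-lower m k + x * D₂.term m m k)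
        ≈⟨ sumTo-cong (m / 3) (λ k _ → sym (𝓘-tilde-summand-split m k)) ⟩
      sumTo (m / 3) (𝓘-tilde-summand (suc m)) ∎
      where
      beyond-third : ∀ k → m / 3 < k → 𝓘-tilde-lower m k ≈ 0#
      beyond-third k h = ι≡0⇒ι*y*z≈0
        (p<q+k⇒[p∸q]Ck≡0 m (suc (2 ℕ.* k)) k (ℕₚ.m<n⇒m<1+n (m/[1+s]<k⇒m<s*k+k 2 h))) _ _

corollary4p2 : ∀ {c ℓ : Level} (R : CommutativeRing c ℓ) (n : ℕ) → n ≥ 1 →
  let open Poly R in ∀ (x : Carrier) →
    (𝓗 x (suc n) - x ^ 2 * 𝓗 x (n ℕ.∸ 1)
      ≈ sumTo (n / 2) (λ k →
          (ι (binomℤ (n ⊖ k) k) + ι (binomℤ (n ⊖ (k ℕ.+ 1)) k) * x)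
            * x ^ k * (1# + x) ^ (n ℕ.∸ k ℕ.∸ 1)))
    ×
    (x * 𝓘 x n + x * 𝓘 x (n ℕ.∸ 1)
      ≈ sumTo ((n ℕ.∸ 1) / 3) (λ k →
          (ι (binomℤ (n ⊖ (2 ℕ.* k ℕ.+ 2)) k) + ι (binomℤ (n ⊖ (2 ℕ.* k ℕ.+ 1)) k) * x)
            * x ^ (n ℕ.∸ 2 ℕ.* k ℕ.∸ 1) * (1# + x) ^ k))
corollary4p2 R (suc m) _ x = 𝓗-tilde-closed-form R x m , 𝓘-tilde-closed-form R x m
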